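{- Let $G$ be a graph, $\Omega$ a potential maximal clique of $G$, $\mathcal{C}$ the set of connected components of $G-\Omega$, and $X_0,Y\subseteq V(G)$ with $Y\cap\Omega=\emptyset$. Call $C\in\mathcal{C}$ active if $C\cap Y\neq\emptyset$, let $A=\Omega\setminus N[X_0]$, and let $B\subseteq A$ be the set of vertices $v\in A$ such that $N(v)\cap Y$ meets at least two components of $\mathcal{C}$. Call two active components $C^1,C^2$ linked if for every $v^1\in B\cap N(C^1)$ and $v^2\in B\cap N(C^2)$ there is an induced path in $G$ with endpoints $v^1$ and $v^2$ and all internal vertices in $V(G)\setminus(N[C^1]\cup N[C^2])$ (one-vertex and two-vertex paths allowed). If two active components $C^1$ and $C^2$ satisfy $N(C^1)\cup N(C^2)\neq\Omega$, then they are linked.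
   Context: Graphs are finite, simple, undirected. $N(v)$, $N[v]$ are open and closed neighbourhoods; for a vertex set $Z$, $N(Z)$ is the set of vertices outside $Z$ with a neighbour in $Z$ and $N[Z]=Z\cup N(Z)$. A potential maximal clique of $G$ is a vertex set inducing a maximal clique in some minimal triangulation of $G$ (a triangulation is a set $F$ of non-edges such that $(V(G),E(G)\cup F)$ is chordal, minimal if no proper subset is one). -}

module Defs where

open import Data.Nat using (ℕ; zero; suc; _≤_; _<_)
open import Data.Fin using (Fin; toℕ; fromℕ)
import Data.Fin
open import Data.Fin.Subset using (Subset; _∈_; _∉_)
open import Data.Bool using (Bool; true; false)
open import Data.Product using (Σ; ∃; ∃-syntax; _×_; _,_)
open import Data.Sum using (_⊎_)
open import Relation.Nullary using (¬_)
open import Relation.Binary.PropositionalEquality using (_≡_; _≢_)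
open import Function.Definitions using (Injective)
open import Function.Bundles using (_⇔_)

record Graph (n : ℕ) : Set where
  field
    adj     : Fin n → Fin n → Bool
    adj-sym : ∀ u v → adj u v ≡ adj v u
    adj-irr : ∀ v → adj v v ≡ false

open Graph public

Adj : ∀ {n} → Graph n → Fin n → Fin n → Set
Adj G u v = adj G u v ≡ true

_⊆E_ : ∀ {n} → Graph n → Graph n → Set
G ⊆E H = ∀ u v → Adj G u v → Adj H u v

CycNext : (k : ℕ) → Fin k → Fin k → Set
CycNext k i j = (toℕ j ≡ suc (toℕ i)) ⊎ ((suc (toℕ i) ≡ k) × (toℕ j ≡ 0))

IsCycle : ∀ {n} → Graph n → (k : ℕ) → (Fin k → Fin n) → Set
IsCycle H k c = Injective _≡_ _≡_ c × (∀ i j → CycNext k i j → Adj H (c i) (c j))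

Chordal : ∀ {n} → Graph n → Set
Chordal {n} H = ∀ (k : ℕ) → 4 ≤ k → (c : Fin k → Fin n) → IsCycle H k c →
  ∃[ i ] ∃[ j ] (Adj H (c i) (c j) × ¬ CycNext k i j × ¬ CycNext k j i)

Triangulation : ∀ {n} → Graph n → Graph n → Set
Triangulation G H = G ⊆E H × Chordal H

MinimalTriangulation : ∀ {n} → Graph n → Graph n → Set
MinimalTriangulation {n} G H = Triangulation G H ×
  (∀ (H' : Graph n) → G ⊆E H' → H' ⊆E H → Chordal H' → H ⊆E H')

IsClique : ∀ {n} → Graph n → Subset n → Set
IsClique H K = ∀ u v → u ∈ K → v ∈ K → u ≢ v → Adj H u v

IsMaximalClique : ∀ {n} → Graph n → Subset n → Set
IsMaximalClique H K = IsClique H K ×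
  (∀ K' → IsClique H K' → (∀ v → v ∈ K → v ∈ K') → ∀ v → v ∈ K' → v ∈ K)

PotentialMaximalClique : ∀ {n} → Graph n → Subset n → Set
PotentialMaximalClique G Ω = ∃[ H ] (MinimalTriangulation G H × IsMaximalClique H Ω)

data WalkIn {n} (G : Graph n) (S : Subset n) : Fin n → Fin n → Set where
  here : ∀ {v} → v ∈ S → WalkIn G S v v
  step : ∀ {u w v} → u ∈ S → Adj G u w → WalkIn G S w v → WalkIn G S u v

IsComponent : ∀ {n} → Graph n → Subset n → Subset n → Set
IsComponent G Ω C =
  (∃[ v ] v ∈ C)
  × (∀ v → v ∈ C → v ∉ Ω)
  × (∀ u v → u ∈ C → v ∈ C → WalkIn G C u v)
  × (∀ u w → u ∈ C → Adj G u w → w ∉ Ω → w ∈ C)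

InN : ∀ {n} → Graph n → Subset n → Fin n → Set
InN G Z v = v ∉ Z × ∃[ u ] (u ∈ Z × Adj G u v)

InNc : ∀ {n} → Graph n → Subset n → Fin n → Set
InNc G Z v = v ∈ Z ⊎ InN G Z v

Active : ∀ {n} → Subset n → Subset n → Set
Active Y C = ∃[ y ] (y ∈ C × y ∈ Y)

InA : ∀ {n} → Graph n → Subset n → Subset n → Fin n → Set
InA G Ω X₀ v = v ∈ Ω × ¬ InNc G X₀ v

InB : ∀ {n} → Graph n → Subset n → Subset n → Subset n → Fin n → Set
InB G Ω X₀ Y v = InA G Ω X₀ v ×
  ∃[ C₁ ] ∃[ C₂ ] (IsComponent G Ω C₁ × IsComponent G Ω C₂ × C₁ ≢ C₂
    × (∃[ y ] (y ∈ C₁ × y ∈ Y × Adj G v y))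
    × (∃[ y ] (y ∈ C₂ × y ∈ Y × Adj G v y)))

InducedPath : ∀ {n} → Graph n → Fin n → Fin n → (Fin n → Set) → Set
InducedPath {n} G v₁ v₂ Int = Σ ℕ λ k → Σ (Fin (suc k) → Fin n) λ p →
  Injective _≡_ _≡_ p
  × p Data.Fin.zero ≡ v₁
  × p (fromℕ k) ≡ v₂
  × (∀ i j → Adj G (p i) (p j) ⇔ ((toℕ j ≡ suc (toℕ i)) ⊎ (toℕ i ≡ suc (toℕ j))))
  × (∀ i → 0 < toℕ i → toℕ i < k → Int (p i))


Linked : ∀ {n} → Graph n → Subset n → Subset n → Subset n → Subset n → Subset n → Set
Linked G Ω X₀ Y C₁ C₂ =
  ∀ v₁ v₂ → InB G Ω X₀ Y v₁ → InN G C₁ v₁ → InB G Ω X₀ Y v₂ → InN G C₂ v₂ →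
  InducedPath G v₁ v₂ (λ w → ¬ InNc G C₁ w × ¬ InNc G C₂ w)

NUnionEq : ∀ {n} → Graph n → Subset n → Subset n → Subset n → Set
NUnionEq G C₁ C₂ Ω = ∀ v → (InN G C₁ v ⊎ InN G C₂ v) ⇔ v ∈ Ω

-- Pick w ∈ Ω outside N(C₁) ∪ N(C₂).  The key fact
-- (a classical property of potential maximal cliques) is that any two vertices s, t of Ω
-- are adjacent in G or both have a neighbour in a common component of G − Ω.  It is
-- proved by minimality: otherwise let R be the vertices reachable from s inside G − Ω;
-- deleting from H all edges between R and the vertices with no neighbour in R keeps H
-- chordal (the vertices in between lie in Ω, a clique, and every cycle crossing over
-- meets them twice non-consecutively), contains G, and loses the edge st.
-- Hence v₁ and v₂ are joined to w through G − Ω; such walks never touch N[C₁] or N[C₂],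
-- since entering C_i would put w into N(C_i).  Concatenating the two walks and
-- shortcutting gives the required induced path.

module Submission where

open import Defs
open import Data.Nat using (ℕ; zero; suc; _+_; _∸_; _≤_; _<_; z≤n; z<s)
import Data.Nat.Properties as ℕ
open import Data.Fin using (Fin; toℕ; fromℕ; fromℕ<) renaming (zero to fzero; suc to fsuc)
import Data.Fin.Properties as Fin
open import Data.Fin.Subset using (Subset; _∈_; _∉_; _∪_; ⁅_⁆; _⊂_; _⊃_)
open import Data.Fin.Subset.Properties using (_∈?_; x∈⁅x⁆; x∈⁅y⁆⇒x≡y; x∈p∪q⁺; x∈p∪q⁻; q⊆p∪q)
open import Data.Fin.Subset.Induction using (⊃-wellFounded)
open import Induction.WellFounded using (Acc; acc)
open import Data.Bool using (Bool; true; false; _∧_; not) renaming (_≟_ to _≟ᵇ_)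
open import Data.Bool.Properties using (¬-not)
open import Data.Product using (Σ; ∃-syntax; _×_; _,_; proj₁; proj₂)
open import Data.Sum using (_⊎_; inj₁; inj₂; [_,_]′)
open import Data.Empty using (⊥; ⊥-elim)
open import Data.List using (List; []; _∷_; length; lookup)
open import Data.List.Relation.Unary.All as All using (All; []; _∷_)
open import Data.List.Relation.Unary.Any using (Any; here; there; any?)
open import Data.List.Relation.Unary.All.Properties.Core using (¬Any⇒All¬)
open import Data.List.Membership.Propositional.Properties using (∈-lookup)
open import Relation.Nullary using (¬_; Dec; yes; no; contradiction)
open import Relation.Nullary.Decidable using (_×-dec_; _⊎-dec_; ¬?)
open import Relation.Binary.Definitions using (tri<; tri≈; tri>)
open import Relation.Binary.PropositionalEquality using (_≡_; _≢_; refl; sym; trans; cong; cong₂; subst)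
open import Function.Definitions using (Injective)
open import Function.Bundles using (_⇔_; mk⇔)
import Function.Properties.Equivalence as ⇔

Consecutive : ℕ → ℕ → Set
Consecutive i j = j ≡ suc i ⊎ i ≡ suc j

consecutive-suc : ∀ {i j} → Consecutive i j ⇔ Consecutive (suc i) (suc j)
consecutive-suc = mk⇔ (λ { (inj₁ eq) → inj₁ (cong suc eq) ; (inj₂ eq) → inj₂ (cong suc eq) })
                      (λ { (inj₁ eq) → inj₁ (ℕ.suc-injective eq) ; (inj₂ eq) → inj₂ (ℕ.suc-injective eq) })

EndOr : ∀ {n} → Fin n → Fin n → (Fin n → Set) → Fin n → Set
EndOr a c S z = z ≡ a ⊎ z ≡ c ⊎ S z

-- Basic facts, walks and induced paths in a fixed graph G

module _ {n : ℕ} (G : Graph n) where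

  Adj-sym : ∀ {u v} → Adj G u v → Adj G v u
  Adj-sym {u} {v} e = trans (adj-sym G v u) e

  Adj-irrefl : ∀ {u} → ¬ Adj G u u
  Adj-irrefl {u} e with trans (sym e) (adj-irr G u)
  ... | ()

  Adj? : ∀ u v → Dec (Adj G u v)
  Adj? u v = adj G u v ≟ᵇ true

  infixr 5 _∷⟨_⟩_
  data Walk (Q : Fin n → Set) : Fin n → Fin n → Set where
    [_]    : ∀ {a} → Q a → Walk Q a a
    _∷⟨_⟩_ : ∀ {a b c} → Q a → Adj G a b → Walk Q b c → Walk Q a c

  Near : Fin n → Fin n → Set
  Near a z = a ≡ z ⊎ Adj G a z

  Near? : ∀ a z → Dec (Near a z)
  Near? a z = (a Fin.≟ z) ⊎-dec Adj? a z

  -- IndPath a c L: the vertex sequence a ∷ L is an induced path from a to c; each vertex is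
  -- adjacent to the next one and neither equal nor adjacent to any vertex after that.
  data IndPath : Fin n → Fin n → List (Fin n) → Set where
    stop : ∀ {a} → IndPath a a []
    step : ∀ {a b c L} → Adj G a b → All (λ z → ¬ Near a z) L → IndPath b c L →
           IndPath a c (b ∷ L)

module _ {n : ℕ} {G : Graph n} where

  head : ∀ {Q a b} → Walk G Q a b → Q a
  head [ q ]          = q
  head (q ∷⟨ _ ⟩ _) = q

  _++ʷ_ : ∀ {Q a b c} → Walk G Q a b → Walk G Q b c → Walk G Q a c
  [ _ ]          ++ʷ W = W
  (q ∷⟨ e ⟩ V) ++ʷ W = q ∷⟨ e ⟩ (V ++ʷ W)

  reverse : ∀ {Q a b} → Walk G Q a b → Walk G Q b a
  reverse [ q ]          = [ q ]
  reverse (q ∷⟨ e ⟩ W) = reverse W ++ʷ (head W ∷⟨ Adj-sym G e ⟩ [ q ])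

  retag : ∀ {Q Q' a b} → (∀ {x} → Walk G Q x b → Q' x) → Walk G Q a b → Walk G Q' a b
  retag f W@([ _ ])        = [ f W ]
  retag f W@(_ ∷⟨ e ⟩ V) = f W ∷⟨ e ⟩ retag f V

  mapWalk : ∀ {Q Q' a b} → (∀ {x} → Q x → Q' x) → Walk G Q a b → Walk G Q' a b
  mapWalk f = retag (λ W → f (head W))

  IndPathIn : (Fin n → Set) → Fin n → Fin n → Set
  IndPathIn T a c = Σ (List (Fin n)) λ L → IndPath G a c L × All T (a ∷ L)

  -- Prepend a to an induced path from b, cutting the path at the last vertex near a.
  attach : ∀ {T a b c L} → T a → IndPath G b c L → All T (b ∷ L) → Any (Near G a) (b ∷ L) →
           IndPathIn T a c
  attach ta stop ts (here (inj₁ refl)) = [] , stop , ts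
  attach ta stop ts (here (inj₂ e))    = _ , step e [] stop , ta ∷ ts
  attach ta stop ts (there ())
  attach {a = a} ta (step {b = b'} {L = L} e far p) (tb ∷ ts) near with any? (Near? G a) (b' ∷ L)
  ... | yes nearLater = attach ta p ts nearLater
  ... | no farLater with near
  ...   | here (inj₁ refl) = _ , step e far p , tb ∷ ts
  ...   | here (inj₂ e')   = _ , step e' (¬Any⇒All¬ _ farLater) (step e far p) , ta ∷ tb ∷ ts
  ...   | there nearLater  = contradiction nearLater farLater

  shorten : ∀ {T a c} → Walk G T a c → IndPathIn T a c
  shorten [ ta ] = [] , stop , ta ∷ []
  shorten (ta ∷⟨ e ⟩ W) with shorten W
  ... | _ , p , ts = attach ta p ts (here (inj₂ e))

  far-from-head : ∀ {a b c L} → IndPath G a c (b ∷ L) → ∀ i → ¬ Near G a (lookup L i)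
  far-from-head (step _ far _) i = All.lookup far (∈-lookup i)

  head-fresh : ∀ {a c L} → IndPath G a c L → ∀ i → a ≢ lookup L i
  head-fresh (step e _ _) fzero    refl = Adj-irrefl G e
  head-fresh p@(step _ _ _) (fsuc i) eq = far-from-head p i (inj₁ eq)

  lookup-last : ∀ {a c L} → IndPath G a c L → lookup (a ∷ L) (fromℕ (length L)) ≡ c
  lookup-last stop           = refl
  lookup-last (step _ _ p) = lookup-last p

  lookup-injective : ∀ {a c L} → IndPath G a c L → Injective _≡_ _≡_ (lookup (a ∷ L))
  lookup-injective p {fzero}  {fzero}  _  = refl
  lookup-injective p {fzero}  {fsuc j} eq = contradiction eq (head-fresh p j)
  lookup-injective p {fsuc i} {fzero}  eq = contradiction (sym eq) (head-fresh p i)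
  lookup-injective (step _ _ p) {fsuc i} {fsuc j} eq = cong fsuc (lookup-injective p eq)

  lookup-adj : ∀ {a c L} → IndPath G a c L → ∀ i j →
               Adj G (lookup (a ∷ L) i) (lookup (a ∷ L) j) ⇔ Consecutive (toℕ i) (toℕ j)
  lookup-adj p fzero fzero = mk⇔ (λ e → contradiction e (Adj-irrefl G)) λ { (inj₁ ()) ; (inj₂ ()) }
  lookup-adj (step e _ _) fzero (fsuc fzero) = mk⇔ (λ _ → inj₁ refl) (λ _ → e)
  lookup-adj p@(step _ _ _) fzero (fsuc (fsuc j)) =
    mk⇔ (λ e → contradiction (inj₂ e) (far-from-head p j)) λ { (inj₁ ()) ; (inj₂ ()) }
  lookup-adj (step e _ _) (fsuc fzero) fzero = mk⇔ (λ _ → inj₂ refl) (λ _ → Adj-sym G e)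
  lookup-adj p@(step _ _ _) (fsuc (fsuc i)) fzero =
    mk⇔ (λ e → contradiction (inj₂ (Adj-sym G e)) (far-from-head p i)) λ { (inj₁ ()) ; (inj₂ ()) }
  lookup-adj (step _ _ p) (fsuc i) (fsuc j) = ⇔.trans (lookup-adj p i j) consecutive-suc

  indPath⇒InducedPath : ∀ {a c L S} → IndPath G a c L → All (EndOr a c S) (a ∷ L) →
                        InducedPath G a c S
  indPath⇒InducedPath {a} {c} {L} {S} p ts =
    length L , lookup (a ∷ L) , lookup-injective p , refl , lookup-last p , lookup-adj p , interior
    where
      -- an interior vertex is neither endpoint, by injectivity
      interior : ∀ i → 0 < toℕ i → toℕ i < length L → S (lookup (a ∷ L) i)
      interior i 0<i i<k with All.lookup ts (∈-lookup i)
      ... | inj₁ atStart = contradiction (sym (cong toℕ (lookup-injective p atStart))) (ℕ.<⇒≢ 0<i)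
      ... | inj₂ (inj₁ atEnd) =
        contradiction (trans (cong toℕ (lookup-injective p (trans atEnd (sym (lookup-last p)))))
                             (Fin.toℕ-fromℕ (length L)))
                      (ℕ.<⇒≢ i<k)
      ... | inj₂ (inj₂ s) = s

  walk⇒InducedPath : ∀ {a c S} → Walk G (EndOr a c S) a c → InducedPath G a c S
  walk⇒InducedPath W with shorten W
  ... | _ , p , ts = indPath⇒InducedPath p ts

-- Cycles coloured by three sides

data Side : Set where
  inner boundary outer : Side

crosses : Side → Side → Bool
crosses inner outer = true
crosses outer inner = true
crosses _     _     = false

crosses-sym : ∀ x y → crosses x y ≡ crosses y x
crosses-sym inner    inner    = refl
crosses-sym inner    boundary = refl
crosses-sym inner    outer    = refl
crosses-sym boundary inner    = refl
crosses-sym boundary boundary = refl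
crosses-sym boundary outer    = refl
crosses-sym outer    inner    = refl
crosses-sym outer    boundary = refl
crosses-sym outer    outer    = refl

crosses-true : ∀ x y → crosses x y ≡ true → (x ≡ inner × y ≡ outer) ⊎ (x ≡ outer × y ≡ inner)
crosses-true inner outer _ = inj₁ (refl , refl)
crosses-true outer inner _ = inj₂ (refl , refl)
crosses-true inner    inner    ()
crosses-true inner    boundary ()
crosses-true boundary inner    ()
crosses-true boundary boundary ()
crosses-true boundary outer    ()
crosses-true outer    boundary ()
crosses-true outer    outer    ()

continue : ∀ {x y} → x ≢ boundary → crosses x y ≡ false → y ≡ x ⊎ y ≡ boundary
continue {inner}    {inner}    _   _  = inj₁ refl
continue {inner}    {boundary} _   _  = inj₂ refl
continue {inner}    {outer}    _   ()
continue {boundary}            x≢b _  = contradiction refl x≢b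
continue {outer}    {inner}    _   ()
continue {outer}    {boundary} _   _  = inj₂ refl
continue {outer}    {outer}    _   _  = inj₁ refl

apart-≢ : ∀ {a b c e} → a < b → b < c → c < e ⊎ e < a → b ≢ e
apart-≢ _   b<c (inj₁ c<e) refl = ℕ.<-asym b<c c<e
apart-≢ a<b _   (inj₂ e<a) refl = ℕ.<-asym a<b e<a

apart-next : ∀ {K a b c e} → a < b → b < c → c < K → c < e ⊎ e < a →
             ¬ (e ≡ suc b ⊎ (suc b ≡ K × e ≡ 0))
apart-next _   b<c _   (inj₁ c<e) (inj₁ refl) = ℕ.<-irrefl refl (ℕ.<-≤-trans b<c (ℕ.≤-pred c<e))
apart-next a<b _   _   (inj₂ e<a) (inj₁ refl) = ℕ.<-asym a<b (ℕ.<-trans (ℕ.n<1+n _) e<a)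
apart-next _   b<c c<K _          (inj₂ (refl , _)) = ℕ.<-irrefl refl (ℕ.<-≤-trans b<c (ℕ.≤-pred c<K))

apart-prev : ∀ {K a b c e} → a < b → b < c → c < e ⊎ e < a →
             ¬ (b ≡ suc e ⊎ (suc e ≡ K × b ≡ 0))
apart-prev _   b<c (inj₁ c<e) (inj₁ refl) = ℕ.<-asym (ℕ.<-trans c<e (ℕ.n<1+n _)) b<c
apart-prev a<b _   (inj₂ e<a) (inj₁ refl) = ℕ.<-irrefl refl (ℕ.<-≤-trans a<b e<a)
apart-prev a<b _   _          (inj₂ (_ , refl)) = ℕ.n≮0 a<b

module Cycle {k : ℕ} (σ : Fin (suc k) → Side)
             (uncrossed : ∀ a b → CycNext (suc k) a b → crosses (σ a) (σ b) ≡ false) where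

  BoundaryIn : Fin (suc k) → Fin (suc k) → Set
  BoundaryIn p q = ∃[ t ] (toℕ p < toℕ t × toℕ t ≤ toℕ q × σ t ≡ boundary)

  scan : ∀ {x} d (p q : Fin (suc k)) → toℕ p + d ≡ toℕ q → x ≢ boundary → σ p ≡ x →
         BoundaryIn p q ⊎ σ q ≡ x
  scan zero p q eq _ σp =
    inj₂ (subst (λ r → σ r ≡ _) (Fin.toℕ-injective (trans (sym (ℕ.+-identityʳ _)) eq)) σp)
  scan {x} (suc d) p q eq x≢b σp = next (continue x≢b uncrossed-p)
    where
      p<q : toℕ p < toℕ q
      p<q = subst (toℕ p <_) eq (ℕ.m<m+n (toℕ p) z<s)
      successor-exists : suc (toℕ p) < suc k
      successor-exists = ℕ.≤-<-trans p<q (Fin.toℕ<n q)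
      p' : Fin (suc k)
      p' = fromℕ< successor-exists
      p'≡ : toℕ p' ≡ suc (toℕ p)
      p'≡ = Fin.toℕ-fromℕ< successor-exists
      uncrossed-p : crosses x (σ p') ≡ false
      uncrossed-p = subst (λ s → crosses s (σ p') ≡ false) σp (uncrossed p p' (inj₁ p'≡))
      next : σ p' ≡ x ⊎ σ p' ≡ boundary → BoundaryIn p q ⊎ σ q ≡ x
      next (inj₂ b) = inj₁ (p' , subst (toℕ p <_) (sym p'≡) (ℕ.n<1+n _) ,
                                 subst (_≤ toℕ q) (sym p'≡) p<q , b)
      next (inj₁ σp') with scan d p' q (trans (cong (_+ d) p'≡) (trans (sym (ℕ.+-suc _ d)) eq)) x≢b σp'
      ... | inj₁ (t , p'<t , t≤q , b) = inj₁ (t , ℕ.<-trans (subst (toℕ p <_) (sym p'≡) (ℕ.n<1+n _)) p'<t , t≤q , b)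
      ... | inj₂ σq = inj₂ σq

  scanUpTo : ∀ {x p q} → toℕ p ≤ toℕ q → x ≢ boundary → σ p ≡ x → BoundaryIn p q ⊎ σ q ≡ x
  scanUpTo {p = p} {q} p≤q = scan (toℕ q ∸ toℕ p) p q (ℕ.m+[n∸m]≡n p≤q)

  before : ∀ {z t r} → toℕ t ≤ toℕ r → σ t ≡ boundary → σ r ≡ z → z ≢ boundary → toℕ t < toℕ r
  before t≤r σt σr z≢b =
    ℕ.≤∧≢⇒< t≤r (λ eq → z≢b (trans (sym σr) (trans (cong σ (sym (Fin.toℕ-injective eq))) σt)))

  TwoSeparators : Set
  TwoSeparators = ∃[ t₁ ] ∃[ t₂ ] (σ t₁ ≡ boundary × σ t₂ ≡ boundary × t₁ ≢ t₂
                                   × ¬ CycNext (suc k) t₁ t₂ × ¬ CycNext (suc k) t₂ t₁)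

  -- Between positions p < q of different non-boundary sides the cycle meets the boundary
  -- once on the arc from p to q and once on the arc from q back to p.
  separators : ∀ {x y p q} → toℕ p < toℕ q → x ≢ boundary → y ≢ boundary → x ≢ y →
               σ p ≡ x → σ q ≡ y → TwoSeparators
  separators {x} {y} {p} {q} p<q x≢b y≢b x≢y σp σq with between | around
    where
      between : ∃[ t ] (toℕ p < toℕ t × toℕ t < toℕ q × σ t ≡ boundary)
      between with scanUpTo (ℕ.<⇒≤ p<q) x≢b σp
      ... | inj₁ (t , p<t , t≤q , b) = t , p<t , before t≤q b σq y≢b , b
      ... | inj₂ σq≡x = contradiction (trans (sym σq≡x) σq) x≢y
      q≤last : toℕ q ≤ toℕ (fromℕ k)
      q≤last = subst (toℕ q ≤_) (sym (Fin.toℕ-fromℕ k)) (ℕ.≤-pred (Fin.toℕ<n q))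
      wrap : CycNext (suc k) (fromℕ k) fzero
      wrap = inj₂ (cong suc (Fin.toℕ-fromℕ k) , refl)
      around : ∃[ t ] ((toℕ q < toℕ t ⊎ toℕ t < toℕ p) × σ t ≡ boundary)
      around with scanUpTo q≤last y≢b σq
      ... | inj₁ (t , q<t , _ , b) = t , inj₁ q<t , b
      ... | inj₂ σlast
            with continue y≢b (subst (λ s → crosses s (σ fzero) ≡ false) σlast (uncrossed _ _ wrap))
      ...   | inj₂ b₀ = fzero , inj₂ (before z≤n b₀ σp x≢b) , b₀
      ...   | inj₁ σ₀ with scanUpTo {p = fzero} {q = p} z≤n y≢b σ₀
      ...     | inj₁ (t , _ , t≤p , b) = t , inj₂ (before t≤p b σp x≢b) , b
      ...     | inj₂ σp≡y = contradiction (trans (sym σp) σp≡y) x≢y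
  ... | t₁ , p<t₁ , t₁<q , b₁ | t₂ , out , b₂ =
    t₁ , t₂ , b₁ , b₂ , (λ eq → apart-≢ p<t₁ t₁<q out (cong toℕ eq)) ,
    apart-next p<t₁ t₁<q (Fin.toℕ<n q) out , apart-prev p<t₁ t₁<q out

  crossingCycle : ∀ i j → σ i ≡ inner → σ j ≡ outer → TwoSeparators
  crossingCycle i j σi σj with ℕ.<-cmp (toℕ i) (toℕ j)
  ... | tri< i<j _ _ = separators i<j (λ ()) (λ ()) (λ ()) σi σj
  ... | tri> _ _ j<i = separators j<i (λ ()) (λ ()) (λ ()) σj σi
  ... | tri≈ _ i≡j _ with Fin.toℕ-injective i≡j
  ...   | refl = contradiction (trans (sym σi) σj) (λ ())

-- Removing the crossing edges of a chordal graph

and-not⁻ : ∀ a b → a ∧ not b ≡ true → a ≡ true × b ≡ false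
and-not⁻ true  false _ = refl , refl
and-not⁻ true  true  ()
and-not⁻ false _     ()

and-not⁺ : ∀ {a b} → a ≡ true → b ≡ false → a ∧ not b ≡ true
and-not⁺ refl refl = refl

module _ {n : ℕ} (H : Graph n) (side : Fin n → Side) where

  removeCrossing : Graph n
  removeCrossing = record
    { adj     = λ u v → adj H u v ∧ not (crosses (side u) (side v))
    ; adj-sym = λ u v → cong₂ _∧_ (adj-sym H u v) (cong not (crosses-sym (side u) (side v)))
    ; adj-irr = λ v → cong (λ b → b ∧ not (crosses (side v) (side v))) (adj-irr H v)
    }

  removeCrossing-adj⁻ : ∀ {u v} → Adj removeCrossing u v →
                        Adj H u v × crosses (side u) (side v) ≡ false
  removeCrossing-adj⁻ {u} {v} = and-not⁻ (adj H u v) (crosses (side u) (side v))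

  removeCrossing-adj⁺ : ∀ {u v} → Adj H u v → crosses (side u) (side v) ≡ false →
                        Adj removeCrossing u v
  removeCrossing-adj⁺ = and-not⁺

  -- If the boundary is a clique of the chordal graph H, removing the crossing edges keeps
  -- it chordal: a cycle using no crossing pair keeps the chord it has in H, and a cycle with
  -- an inner and an outer vertex has a chord between two of its boundary vertices.
  removeCrossing-chordal : Chordal H →
                           (∀ u v → side u ≡ boundary → side v ≡ boundary → u ≢ v → Adj H u v) →
                           Chordal removeCrossing
  removeCrossing-chordal _ _ zero () _ _
  removeCrossing-chordal chordal boundaryClique (suc k) 4≤k c (inj , edges)
    with Fin.any? (λ i → Fin.any? (λ j → crosses (side (c i)) (side (c j)) ≟ᵇ true))
  ... | yes (i , j , cross) = fromSeparators ([ (λ (σi , σj) → crossingCycle i j σi σj)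
                                               , (λ (σi , σj) → crossingCycle j i σj σi) ]′
                                               (crosses-true _ _ cross))
    where
      open Cycle (λ t → side (c t)) (λ a b cn → proj₂ (removeCrossing-adj⁻ (edges a b cn)))
      fromSeparators : TwoSeparators → ∃[ i ] ∃[ j ] (Adj removeCrossing (c i) (c j)
                                        × ¬ CycNext (suc k) i j × ¬ CycNext (suc k) j i)
      fromSeparators (t₁ , t₂ , b₁ , b₂ , t₁≢t₂ , n₁ , n₂) =
        t₁ , t₂ , removeCrossing-adj⁺ (boundaryClique _ _ b₁ b₂ (λ eq → t₁≢t₂ (inj eq)))
                                      (cong₂ crosses b₁ b₂) , n₁ , n₂
  ... | no noCrossing
    with chordal (suc k) 4≤k c (inj , λ a b cn → proj₁ (removeCrossing-adj⁻ (edges a b cn)))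
  ...   | i , j , e , n₁ , n₂ =
    i , j , removeCrossing-adj⁺ e (¬-not λ cross → noCrossing (i , j , cross)) , n₁ , n₂

-- Exploring G − Ω from a vertex s

module _ {n : ℕ} (G : Graph n) (Ω : Subset n) where

  Joined : Fin n → Fin n → Set
  Joined u s = Walk G (λ z → z ≡ s ⊎ z ∉ Ω) u s

  Closed : Subset n → Set
  Closed R = ∀ {u v} → u ∈ R → Adj G u v → v ∉ R → v ∈ Ω

  Explored : Fin n → Subset n → Set
  Explored s R = s ∈ R × (∀ {u} → u ∈ R → Joined u s)

  -- Add vertices along edges into G − Ω until none is left; each step strictly enlarges R.
  explore : ∀ {s} R → Acc _⊃_ R → Explored s R → Σ (Subset n) λ R' → Explored s R' × Closed R'
  explore {s} R (acc larger) (s∈R , joined)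
    with Fin.any? (λ u → Fin.any? (λ v → (u ∈? R) ×-dec Adj? G u v ×-dec ¬? (v ∈? R) ×-dec ¬? (v ∈? Ω)))
  ... | yes (u , v , u∈R , e , v∉R , v∉Ω) =
    explore (⁅ v ⁆ ∪ R) (larger grows) (q⊆p∪q ⁅ v ⁆ R s∈R , joined')
    where
      grows : R ⊂ ⁅ v ⁆ ∪ R
      grows = q⊆p∪q ⁅ v ⁆ R , v , x∈p∪q⁺ (inj₁ (x∈⁅x⁆ v)) , v∉R
      joined' : ∀ {x} → x ∈ ⁅ v ⁆ ∪ R → Joined x s
      joined' x∈ with x∈p∪q⁻ ⁅ v ⁆ R x∈
      ... | inj₁ x∈⁅v⁆ rewrite x∈⁅y⁆⇒x≡y v x∈⁅v⁆ = inj₂ v∉Ω ∷⟨ Adj-sym G e ⟩ joined u∈R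
      ... | inj₂ x∈R = joined x∈R
  ... | no noExit = R , (s∈R , joined) , closed
    where
      closed : Closed R
      closed {u} {v} u∈R e v∉R with v ∈? Ω
      ... | yes v∈Ω = v∈Ω
      ... | no v∉Ω  = contradiction (u , v , u∈R , e , v∉R , v∉Ω) noExit

  reachable : ∀ s → Σ (Subset n) λ R → Explored s R × Closed R
  reachable s = explore ⁅ s ⁆ (⊃-wellFounded _) (x∈⁅x⁆ s , start)
    where
      start : ∀ {u} → u ∈ ⁅ s ⁆ → Joined u s
      start u∈ rewrite x∈⁅y⁆⇒x≡y s u∈ = [ inj₁ refl ]

  module Sides {R : Subset n} (closed : Closed R) where

    NeighbourIn : Fin n → Set
    NeighbourIn u = ∃[ z ] (z ∈ R × Adj G z u)

    NeighbourIn? : ∀ u → Dec (NeighbourIn u)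
    NeighbourIn? u = Fin.any? (λ z → (z ∈? R) ×-dec Adj? G z u)

    side : Fin n → Side
    side u with u ∈? R | NeighbourIn? u
    ... | yes _ | _     = inner
    ... | no _  | yes _ = boundary
    ... | no _  | no _  = outer

    inner-of-∈ : ∀ {u} → u ∈ R → side u ≡ inner
    inner-of-∈ {u} u∈R with u ∈? R | NeighbourIn? u
    ... | yes _   | _ = refl
    ... | no u∉R  | _ = contradiction u∈R u∉R

    ∈-of-inner : ∀ {u} → side u ≡ inner → u ∈ R
    ∈-of-inner {u} with u ∈? R | NeighbourIn? u
    ... | yes u∈R | _     = λ _ → u∈R
    ... | no _    | yes _ = λ ()
    ... | no _    | no _  = λ ()

    boundary⊆Ω : ∀ {u} → side u ≡ boundary → u ∈ Ω
    boundary⊆Ω {u} with u ∈? R | NeighbourIn? u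
    ... | yes _   | _                   = λ ()
    ... | no u∉R  | yes (z , z∈R , e) = λ _ → closed z∈R e u∉R
    ... | no _    | no _                = λ ()

    outer-isolated : ∀ {u} → side u ≡ outer → ¬ NeighbourIn u
    outer-isolated {u} with u ∈? R | NeighbourIn? u
    ... | yes _ | _          = λ ()
    ... | no _  | yes _      = λ ()
    ... | no _  | no isolated = λ _ → isolated

    outer-of-isolated : ∀ {u} → u ∉ R → ¬ NeighbourIn u → side u ≡ outer
    outer-of-isolated {u} u∉R isolated with u ∈? R | NeighbourIn? u
    ... | yes u∈R | _         = contradiction u∈R u∉R
    ... | no _    | yes nbr   = contradiction nbr isolated
    ... | no _    | no _      = refl

    uncrossed-edge : ∀ {u v} → Adj G u v → crosses (side u) (side v) ≡ false
    uncrossed-edge {u} {v} e = ¬-not λ cross →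
      [ (λ (σu , σv) → outer-isolated σv (u , ∈-of-inner σu , e))
      , (λ (σu , σv) → outer-isolated σu (v , ∈-of-inner σv , Adj-sym G e)) ]′
      (crosses-true _ _ cross)

clique-joined : ∀ {n} {G H : Graph n} {Ω : Subset n} → MinimalTriangulation G H → IsClique H Ω →
                ∀ {s t} → s ∈ Ω → t ∈ Ω → s ≢ t → ∃[ u ] (Adj G t u × Joined G Ω u s)
clique-joined {n} {G} {H} {Ω} ((G⊆H , chordal) , minimal) clique {s} {t} s∈Ω t∈Ω s≢t
  with reachable G Ω s
... | R , (s∈R , joined) , closed
  with Fin.any? (λ u → (u ∈? R) ×-dec Adj? G t u)
...   | yes (u , u∈R , e) = u , e , joined u∈R
...   | no isolated = ⊥-elim separated
  where
    open Sides G Ω closed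

    -- t is not explored: its walk to s would put t outside Ω
    t∉R : t ∉ R
    t∉R t∈R with head (joined t∈R)
    ... | inj₁ t≡s = s≢t (sym t≡s)
    ... | inj₂ t∉Ω = t∉Ω t∈Ω

    H' : Graph n
    H' = removeCrossing H side

    -- By minimality H' = H, yet H' has lost the edge st of the clique Ω.
    H⊆H' : H ⊆E H'
    H⊆H' = minimal H'
      (λ u v e → removeCrossing-adj⁺ H side (G⊆H u v e) (uncrossed-edge e))
      (λ u v e → proj₁ (removeCrossing-adj⁻ H side e))
      (removeCrossing-chordal H side chordal
        (λ u v σu σv → clique u v (boundary⊆Ω σu) (boundary⊆Ω σv)))

    t-outer : side t ≡ outer
    t-outer = outer-of-isolated t∉R (λ (z , z∈R , e) → isolated (z , z∈R , Adj-sym G e))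

    separated : ⊥
    separated = contradiction
      (trans (sym (cong₂ crosses (inner-of-∈ s∈R) t-outer))
             (proj₂ (removeCrossing-adj⁻ H side (H⊆H' s t (clique s t s∈Ω t∈Ω s≢t)))))
      (λ ())

-- Components of G − Ω and their neighbourhoods

InN? : ∀ {n} (G : Graph n) (C : Subset n) v → Dec (InN G C v)
InN? G C v = ¬? (v ∈? C) ×-dec Fin.any? (λ u → (u ∈? C) ×-dec Adj? G u v)

module _ {n : ℕ} {G : Graph n} {Ω C : Subset n} (component : IsComponent G Ω C) where

  private
    disjoint : ∀ v → v ∈ C → v ∉ Ω
    disjoint = proj₁ (proj₂ component)

    absorbs : ∀ u w → u ∈ C → Adj G u w → w ∉ Ω → w ∈ C
    absorbs = proj₂ (proj₂ (proj₂ component))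

  neighbourhood⊆Ω : ∀ {v} → InN G C v → v ∈ Ω
  neighbourhood⊆Ω {v} (v∉C , u , u∈C , e) with v ∈? Ω
  ... | yes v∈Ω = v∈Ω
  ... | no v∉Ω  = contradiction (absorbs u v u∈C e v∉Ω) v∉C

  exit-through : ∀ {w a} → w ∈ Ω → a ∈ C → Joined G Ω a w → InN G C w
  exit-through w∈Ω a∈C [ _ ] = contradiction w∈Ω (disjoint _ a∈C)
  exit-through w∈Ω a∈C (_ ∷⟨ e ⟩ W) with head W
  ... | inj₁ refl = (λ w∈C → disjoint _ w∈C w∈Ω) , _ , a∈C , e
  ... | inj₂ b∉Ω  = exit-through w∈Ω (absorbs _ _ a∈C e b∉Ω) W

  joined-avoids : ∀ {w a} → w ∈ Ω → ¬ InN G C w → Joined G Ω a w → ¬ InNc G C a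
  joined-avoids w∈Ω w∉N W (inj₁ a∈C) = w∉N (exit-through w∈Ω a∈C W)
  joined-avoids w∈Ω w∉N W (inj₂ a∈N) with head W
  ... | inj₁ refl = w∉N a∈N
  ... | inj₂ a∉Ω  = a∉Ω (neighbourhood⊆Ω a∈N)

outside-neighbourhoods : ∀ {n} {G : Graph n} {Ω C₁ C₂ : Subset n} →
                         IsComponent G Ω C₁ → IsComponent G Ω C₂ → ¬ NUnionEq G C₁ C₂ Ω →
                         ∃[ w ] (w ∈ Ω × ¬ InN G C₁ w × ¬ InN G C₂ w)
outside-neighbourhoods {G = G} {Ω} {C₁} {C₂} comp₁ comp₂ notUnion
  with Fin.any? (λ w → (w ∈? Ω) ×-dec ¬? (InN? G C₁ w) ×-dec ¬? (InN? G C₂ w))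
... | yes found = found
... | no none = contradiction
      (λ v → mk⇔ [ neighbourhood⊆Ω comp₁ , neighbourhood⊆Ω comp₂ ]′ (covered v)) notUnion
  where
    covered : ∀ v → v ∈ Ω → InN G C₁ v ⊎ InN G C₂ v
    covered v v∈Ω with InN? G C₁ v | InN? G C₂ v
    ... | yes v∈N₁ | _        = inj₁ v∈N₁
    ... | no _     | yes v∈N₂ = inj₂ v∈N₂
    ... | no v∉N₁  | no v∉N₂  = contradiction (v , v∈Ω , v∉N₁ , v∉N₂) none

Avoiding : ∀ {n} → Graph n → Subset n → Subset n → Fin n → Set
Avoiding G C₁ C₂ z = ¬ InNc G C₁ z × ¬ InNc G C₂ z

avoiding-walk : ∀ {n} {G H : Graph n} {Ω C₁ C₂ : Subset n} {w v} →
                MinimalTriangulation G H → IsClique H Ω →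
                IsComponent G Ω C₁ → IsComponent G Ω C₂ →
                w ∈ Ω → ¬ InN G C₁ w → ¬ InN G C₂ w → v ∈ Ω → v ≢ w →
                Walk G (λ z → z ≡ v ⊎ Avoiding G C₁ C₂ z) v w
avoiding-walk {G = G} {H} {Ω} minimalTri clique comp₁ comp₂ w∈Ω w∉N₁ w∉N₂ v∈Ω v≢w
  with clique-joined {G = G} {H} {Ω} minimalTri clique w∈Ω v∈Ω (λ w≡v → v≢w (sym w≡v))
... | u , e , W = inj₁ refl ∷⟨ e ⟩
  retag (λ W' → inj₂ (joined-avoids comp₁ w∈Ω w∉N₁ W' , joined-avoids comp₂ w∈Ω w∉N₂ W')) W

lemma16 : (n : ℕ) (G : Graph n) (Ω X₀ Y : Subset n)
    → PotentialMaximalClique G Ω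
    → (∀ v → v ∈ Y → v ∉ Ω)
    → (C₁ C₂ : Subset n)
    → IsComponent G Ω C₁ → IsComponent G Ω C₂ → C₁ ≢ C₂
    → Active Y C₁ → Active Y C₂
    → ¬ NUnionEq G C₁ C₂ Ω
    → Linked G Ω X₀ Y C₁ C₂
lemma16 n G Ω X₀ Y (H , minimalTri , clique , _) _ C₁ C₂ comp₁ comp₂ _ _ _ notUnion
        v₁ v₂ ((v₁∈Ω , _) , _) v₁∈N₁ ((v₂∈Ω , _) , _) v₂∈N₂
  with outside-neighbourhoods comp₁ comp₂ notUnion
... | w , w∈Ω , w∉N₁ , w∉N₂ =
  walk⇒InducedPath (mapWalk fromStart segment₁ ++ʷ reverse (mapWalk fromEnd segment₂))
  where
    Inner : Fin n → Set
    Inner = Avoiding G C₁ C₂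

    segment₁ : Walk G (λ z → z ≡ v₁ ⊎ Inner z) v₁ w
    segment₁ = avoiding-walk {H = H} {Ω} minimalTri clique comp₁ comp₂ w∈Ω w∉N₁ w∉N₂ v₁∈Ω
                 (λ v₁≡w → w∉N₁ (subst (InN G C₁) v₁≡w v₁∈N₁))

    segment₂ : Walk G (λ z → z ≡ v₂ ⊎ Inner z) v₂ w
    segment₂ = avoiding-walk {H = H} {Ω} minimalTri clique comp₁ comp₂ w∈Ω w∉N₁ w∉N₂ v₂∈Ω
                 (λ v₂≡w → w∉N₂ (subst (InN G C₂) v₂≡w v₂∈N₂))

    fromStart : ∀ {z} → z ≡ v₁ ⊎ Inner z → EndOr v₁ v₂ Inner z
    fromStart = [ inj₁ , (λ a → inj₂ (inj₂ a)) ]′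

    fromEnd : ∀ {z} → z ≡ v₂ ⊎ Inner z → EndOr v₁ v₂ Inner z
    fromEnd = [ (λ e → inj₂ (inj₁ e)) , (λ a → inj₂ (inj₂ a)) ]′
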